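{- For a positive integer $n$, $T^\ast(n)=1$ if and only if $n$ is prime.
   Context: For a vector $A=(a_1,\ldots,a_k)$, $k\geq 1$, of positive integers define $f(A)$ recursively by $f(a_1)=a_1$ and $f(a_1,\ldots,a_{i+1})=(f(a_1,\ldots,a_i)+1)\,a_{i+1}$. For a positive integer $n$, $T(n)$ is the number of vectors $A$ (of any length $k\geq1$, with positive integer entries) such that $f(A)=n$; also $T(0):=1$. For $n\geq1$, $T^\ast(n):=T(n)-T(n-1)$. -}

module Defs where

open import Data.Nat using (ℕ; zero; suc; _+_; _*_; NonZero)
open import Data.List using (foldl)
open import Data.List.NonEmpty using (List⁺; _∷_; toList)
open import Data.List.Relation.Unary.All using (All)
open import Data.Fin using (Fin)
open import Data.Product using (Σ; _×_; _,_)
open import Function.Bundles using (_↔_)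
open import Relation.Binary.PropositionalEquality using (_≡_)

PosVec : Set
PosVec = Σ (List⁺ ℕ) (λ as → All NonZero (toList as))

-- f(a₁) = a₁,  f(a₁,…,a_{i+1}) = (f(a₁,…,a_i) + 1) · a_{i+1}
fList : List⁺ ℕ → ℕ
fList (a ∷ as) = foldl (λ acc x → (acc + 1) * x) a as

f : PosVec → ℕ
f (as , _) = fList as

Sol : ℕ → Set
Sol n = Σ PosVec (λ A → f A ≡ n)

-- "T(n) = k": for n ≥ 1, k is the number of vectors A with f(A) = n,
-- i.e. the solution set is in bijection with Fin k; and T(0) := 1.
IsT : ℕ → ℕ → Set
IsT zero    k = k ≡ 1
IsT (suc m) k = Fin k ↔ Sol (suc m)

module Submission where

-- Write n = m + 1 and let Sol n be the set of positive vectors A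
-- with f(A) = n.  Every A ∈ Sol n is either the one-entry vector (n), or has
-- the form A = B ++ (x) with (f(B) + 1)·x = n and f(B) ≥ 1.  Hence
--   * (n), together with B ↦ B ++ (1) on Sol m, embeds 1 + Sol m into Sol n,
--     so T(n) ≥ T(n-1) + 1;
--   * if n is irreducible, then f(B) + 1 ≥ 2 divides n, forcing f(B) + 1 = n
--     and x = 1; the embedding is then onto, so T(n) ≤ T(n-1) + 1;
--   * if n = (c+2)(r+2) is composite, the vector (c+1, r+2) is a further
--     solution outside that image, so T(n) ≥ T(n-1) + 2.
-- The file first proves the counting facts about finite types, then the
-- structural facts about solutions, then these three bounds; the theorem
-- follows by comparing them (the case n = 1 uses Sol 0 = ∅ and T(0) = 1).

open import Defs
open import Data.Nat
  using (ℕ; zero; suc; _+_; _*_; _≤_; _<_; NonZero; s≤s; >-nonZero⁻¹; nonTrivial⇒n>1)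
open import Data.Nat.Properties
  using (≤-refl; ≤-trans; ≤-antisym; m≤m+n; m≤m*n; +-comm; *-comm; *-identityʳ; *-cancelˡ-≡;
         suc-injective; 1+n≰n; <-irrefl; ≡-irrelevant; +-monoˡ-≤; +-identityʳ)
open import Data.Nat.Divisibility using (divides)
open import Data.Nat.Primality
  using (Prime; Composite; composite; Irreducible; prime?; prime⇒irreducible; irreducible[1];
         ¬prime[1]; ¬prime⇒composite)
open import Data.List using (List; []; _∷_; _∷ʳ_; InitLast; initLast; _∷ʳ′_)
open import Data.List.Properties using (foldl-∷ʳ; ∷ʳ-injectiveˡ; ∷ʳ-injectiveʳ)
open import Data.List.NonEmpty as List⁺ using (List⁺; _∷_)
open import Data.List.Relation.Unary.All as All using (All; []; _∷_)
open import Data.List.Relation.Unary.All.Properties using (++⁻ˡ; ∷ʳ⁺)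
open import Data.Fin using (Fin)
open import Data.Fin.Properties using (injective⇒≤; +↔⊎; 1↔⊤)
open import Data.Product using (Σ; ∃₂; _,_; proj₁; proj₂)
open import Data.Sum using (_⊎_; inj₁; inj₂; [_,_]′)
open import Data.Sum.Function.Propositional using (_⊎-↔_)
open import Data.Unit using (⊤; tt)
open import Data.Empty using (⊥; ⊥-elim)
open import Function using (_∘_; const)
open import Function.Bundles using (_⇔_; _↔_; mk⇔; mk↔ₛ′; Injection)
open import Function.Definitions using (Injective)
open import Function.Properties.Inverse using (↔⇒↣; ↔-sym; ↔-trans)
open import Relation.Binary.PropositionalEquality
open import Relation.Nullary using (contradiction)
open import Relation.Nullary.Decidable using (decidable-stable)

injection⇒≤ : ∀ {a b} {X Y : Set} → Fin a ↔ X → Fin b ↔ Y →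
              (g : Y → X) → Injective _≡_ _≡_ g → b ≤ a
injection⇒≤ A B g g-inj =
  injective⇒≤ (Injection.injective (↔⇒↣ B) ∘ g-inj ∘ Injection.injective (↔⇒↣ (↔-sym A)))

section⇒injective : {X Y : Set} (g : Y → X) (s : X → Y) →
                    (∀ x → g (s x) ≡ x) → Injective _≡_ _≡_ s
section⇒injective g s gs {x} {x′} eq = trans (sym (gs x)) (trans (cong g eq) (gs x′))

adjoin-size : ∀ {b} {Y : Set} → Fin b ↔ Y → Fin (suc b) ↔ (⊤ ⊎ Y)
adjoin-size B = ↔-trans +↔⊎ (1↔⊤ ⊎-↔ B)

adjoin : {X Y : Set} → X → (Y → X) → ⊤ ⊎ Y → X
adjoin x g = [ const x , g ]′

adjoin-injective : {X Y : Set} (x : X) (g : Y → X) → Injective _≡_ _≡_ g →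
                   (∀ y → g y ≢ x) → Injective _≡_ _≡_ (adjoin x g)
adjoin-injective x g g-inj x∉g {inj₁ tt} {inj₁ tt} _  = refl
adjoin-injective x g g-inj x∉g {inj₁ tt} {inj₂ y}  eq = ⊥-elim (x∉g y (sym eq))
adjoin-injective x g g-inj x∉g {inj₂ y}  {inj₁ tt} eq = ⊥-elim (x∉g y eq)
adjoin-injective x g g-inj x∉g {inj₂ y}  {inj₂ y′} eq = cong inj₂ (g-inj eq)

adjoin⇒< : ∀ {a b} {X Y : Set} → Fin a ↔ X → Fin b ↔ Y → (x : X) (g : Y → X) →
           Injective _≡_ _≡_ g → (∀ y → g y ≢ x) → suc b ≤ a
adjoin⇒< A B x g g-inj x∉g =
  injection⇒≤ A (adjoin-size B) (adjoin x g) (adjoin-injective x g g-inj x∉g)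

fList-snoc : ∀ a as x → fList (a ∷ (as ∷ʳ x)) ≡ (fList (a ∷ as) + 1) * x
fList-snoc a as x = foldl-∷ʳ (λ acc y → (acc + 1) * y) a x as

-- Positive entries never decrease the running value, so f(A) ≥ a₁.
head≤fList : ∀ a as → All NonZero as → a ≤ fList (a ∷ as)
head≤fList a []           []       = ≤-refl
head≤fList a (suc x ∷ as) (_ ∷ ps) =
  ≤-trans (≤-trans (m≤m+n a 1) (m≤m*n (a + 1) (suc x))) (head≤fList ((a + 1) * suc x) as ps)

entries : ∀ {n} → Sol n → List⁺ ℕ
entries ((as , _) , _) = as

-- NonZero n has at most one proof; with ≡-irrelevant this makes Sol n a set of lists.
nonZero-irrelevant : ∀ {n} (p q : NonZero n) → p ≡ q
nonZero-irrelevant {suc n} _ _ = refl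

Sol-ext : ∀ {n} (A B : Sol n) → entries A ≡ entries B → A ≡ B
Sol-ext ((as , ps) , e) ((.as , qs) , e′) refl
  rewrite All.irrelevant nonZero-irrelevant ps qs | ≡-irrelevant e e′ = refl

-- Since f(A) ≥ a₁ ≥ 1, there are no solutions for n = 0.
noSolution₀ : Fin 0 ↔ Sol 0
noSolution₀ = mk↔ₛ′ (λ ()) (⊥-elim ∘ absurd) (⊥-elim ∘ absurd) (λ ())
  where
  absurd : Sol 0 → ⊥
  absurd (((zero ∷ _) , (nz ∷ _)) , _) = NonZero.nonZero nz
  absurd (((suc a ∷ as) , (_ ∷ ps)) , e) with subst (suc a ≤_) e (head≤fList (suc a) as ps)
  ... | ()

single : ∀ m → Sol (suc m)
single m = ((suc m ∷ []) , (_ ∷ [])) , refl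

appendOne : ∀ {m} → Sol m → Sol (suc m)
appendOne {m} (((a ∷ as) , (nz ∷ ps)) , e) = ((a ∷ (as ∷ʳ 1)) , (nz ∷ ∷ʳ⁺ ps _)) , value
  where
  open ≡-Reasoning
  value : fList (a ∷ (as ∷ʳ 1)) ≡ suc m
  value = begin
    fList (a ∷ (as ∷ʳ 1))   ≡⟨ fList-snoc a as 1 ⟩
    (fList (a ∷ as) + 1) * 1 ≡⟨ *-identityʳ _ ⟩
    fList (a ∷ as) + 1       ≡⟨ +-comm _ 1 ⟩
    suc (fList (a ∷ as))     ≡⟨ cong suc e ⟩
    suc m                    ∎

appendOne-injective : ∀ {m} → Injective _≡_ _≡_ (appendOne {m})
appendOne-injective {x = A@(((a ∷ as) , (_ ∷ _)) , _)} {y = B@(((b ∷ bs) , (_ ∷ _)) , _)} eq =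
  Sol-ext A B (cong₂ _∷_ (cong List⁺.head same) (∷ʳ-injectiveˡ as bs (cong List⁺.tail same)))
  where
  same : entries (appendOne A) ≡ entries (appendOne B)
  same = cong entries eq

∷ʳ≢[] : ∀ (xs : List ℕ) x → xs ∷ʳ x ≢ []
∷ʳ≢[] []      x ()
∷ʳ≢[] (_ ∷ _) x ()

appendOne≢single : ∀ {m} (A : Sol m) → appendOne A ≢ single m
appendOne≢single (((a ∷ as) , (_ ∷ _)) , _) eq = ∷ʳ≢[] as 1 (cong (List⁺.tail ∘ entries) eq)

grow : ∀ m → ⊤ ⊎ Sol m → Sol (suc m)
grow m = adjoin (single m) appendOne

grow-injective : ∀ m → Injective _≡_ _≡_ (grow m)
grow-injective m = adjoin-injective (single m) appendOne appendOne-injective appendOne≢single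

lowerBound : ∀ {m a b} → Fin a ↔ Sol (suc m) → Fin b ↔ Sol m → suc b ≤ a
lowerBound A B = adjoin⇒< A B (single _) appendOne appendOne-injective appendOne≢single

irreducible-cofactor : ∀ {n d x} → Irreducible n → 1 < d → d * x ≡ n → x ≡ 1
irreducible-cofactor {d = suc (suc c)} {x} irr (s≤s (s≤s _)) dx≡n
  with irr (divides x (trans (sym dx≡n) (*-comm (2 + c) x)))
... | inj₂ refl = *-cancelˡ-≡ x 1 (2 + c) (trans dx≡n (sym (*-identityʳ (2 + c))))

-- For irreducible m + 1, the last entry x of a solution B ++ (x) satisfies
-- (f(B) + 1)·x = m + 1 with f(B) + 1 ≥ 2, so x = 1 and f(B) = m.
irreducible-classify : ∀ {m} → Irreducible (suc m) →
                       (A : Sol (suc m)) → Σ (⊤ ⊎ Sol m) λ z → grow m z ≡ A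
irreducible-classify {m} irr (((a ∷ as) , (nz ∷ ps)) , e) = split as (initLast as) ps e
  where
  split : ∀ as → InitLast as → (ps : All NonZero as) (e : fList (a ∷ as) ≡ suc m) →
          Σ (⊤ ⊎ Sol m) λ z → grow m z ≡ (((a ∷ as) , (nz ∷ ps)) , e)
  split .[] [] [] e = inj₁ tt , Sol-ext _ _ (cong (_∷ []) (sym e))
  split .(init ∷ʳ x) (init ∷ʳ′ x) ps e =
    inj₂ (((a ∷ init) , (nz ∷ ++⁻ˡ init ps)) , F≡m) ,
    Sol-ext _ _ (cong (λ y → a ∷ (init ∷ʳ y)) (sym x≡1))
    where
    open ≡-Reasoning
    F : ℕ
    F = fList (a ∷ init)
    F+1>1 : 1 < F + 1
    F+1>1 = +-monoˡ-≤ 1 (≤-trans (>-nonZero⁻¹ a {{nz}}) (head≤fList a init (++⁻ˡ init ps)))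
    product : (F + 1) * x ≡ suc m
    product = trans (sym (fList-snoc a init x)) e
    x≡1 : x ≡ 1
    x≡1 = irreducible-cofactor irr F+1>1 product
    F≡m : F ≡ m
    F≡m = suc-injective (begin
      suc F         ≡⟨ +-comm 1 F ⟩
      F + 1         ≡⟨ *-identityʳ (F + 1) ⟨
      (F + 1) * 1   ≡⟨ cong ((F + 1) *_) x≡1 ⟨
      (F + 1) * x   ≡⟨ product ⟩
      suc m         ∎)

upperBound : ∀ {m a b} → Irreducible (suc m) → Fin a ↔ Sol (suc m) → Fin b ↔ Sol m → a ≤ suc b
upperBound {m} irr A B =
  injection⇒≤ (adjoin-size B) A classify
    (section⇒injective (grow m) classify (proj₂ ∘ irreducible-classify irr))
  where
  classify : Sol (suc m) → ⊤ ⊎ Sol m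
  classify = proj₁ ∘ irreducible-classify irr

composite⇒product : ∀ {n} → Composite n → ∃₂ λ c r → (2 + c) * (2 + r) ≡ n
composite⇒product (composite {d} d<n (divides q n≡q*d)) = factors d q (nonTrivial⇒n>1 d) d<n n≡q*d
  where
  factors : ∀ {n} d q → 1 < d → d < n → n ≡ q * d → ∃₂ λ c r → (2 + c) * (2 + r) ≡ n
  factors (suc (suc c)) zero          (s≤s (s≤s _)) ()  refl
  factors (suc (suc c)) (suc zero)    (s≤s (s≤s _)) d<n refl =
    contradiction d<n (<-irrefl (sym (+-identityʳ (2 + c))))
  factors (suc (suc c)) (suc (suc r)) (s≤s (s≤s _)) _   refl = c , r , *-comm (2 + c) (2 + r)

twoEntry : ∀ {n} c r → (2 + c) * (2 + r) ≡ n → Sol n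
twoEntry c r eq =
  ((suc c ∷ (2 + r ∷ [])) , (_ ∷ (_ ∷ []))) , trans (cong (_* (2 + r)) (+-comm (suc c) 1)) eq

-- Its last entry is not 1 and it has two entries, so grow misses it.
twoEntry∉grow : ∀ {m} c r (eq : (2 + c) * (2 + r) ≡ suc m) (z : ⊤ ⊎ Sol m) →
                grow m z ≢ twoEntry c r eq
twoEntry∉grow c r eq (inj₁ tt) ()
twoEntry∉grow c r eq (inj₂ (((a ∷ as) , (_ ∷ _)) , _)) same
  with () ← ∷ʳ-injectiveʳ as [] (cong (List⁺.tail ∘ entries) same)

compositeBound : ∀ {m a b} → Composite (suc m) →
                 Fin a ↔ Sol (suc m) → Fin b ↔ Sol m → suc (suc b) ≤ a
compositeBound {m} n-composite A B with c , r , eq ← composite⇒product n-composite =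
  adjoin⇒< A (adjoin-size B) (twoEntry c r eq) (grow m) (grow-injective m) (twoEntry∉grow c r eq)

mainTheorem10 : (m a b : ℕ) → IsT (suc m) a → IsT m b → (a ≡ suc b) ⇔ Prime (suc m)
mainTheorem10 zero a b A refl = mk⇔ notTwo (λ p → contradiction p ¬prime[1])
  where
  -- Sol 0 = ∅ and 1 is irreducible, so T(1) ≤ 1.
  notTwo : a ≡ 2 → Prime 1
  notTwo a≡2 = contradiction (subst (_≤ 1) a≡2 (upperBound irreducible[1] A noSolution₀)) 1+n≰n
mainTheorem10 (suc m) a b A B = mk⇔ toPrime fromPrime
  where
  fromPrime : Prime (2 + m) → a ≡ suc b
  fromPrime p = ≤-antisym (upperBound (prime⇒irreducible p) A B) (lowerBound A B)
  toPrime : a ≡ suc b → Prime (2 + m)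
  toPrime a≡1+b = decidable-stable (prime? (2 + m)) λ ¬p →
    1+n≰n (subst (2 + b ≤_) a≡1+b (compositeBound (¬prime⇒composite ¬p) A B))
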